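{- Let $\mathcal{T}$ be a GST of a graph $G$ with $n$ nodes rooted at $s$, and let $G'$ be the associated virtual directed graph. Then for every node $u$, the virtual-distance satisfies $d_u\le 2\lceil\log_2 n\rceil$.
   Context: Ranked BFS tree: a BFS tree $\mathcal{T}$ of a connected graph $G$ rooted at $s$, each non-root node's parent being a $G$-neighbor one level closer to $s$; ranks: leaves get rank $1$; an internal node whose children have maximum rank $r$ gets rank $r$ if exactly one child has rank $r$ and $r+1$ otherwise (so all ranks are at most $\lceil\log_2 n\rceil$). It is a GST if whenever $u_1\neq u_2$ of rank $r$ at the same level have parents $v_1\neq v_2$ both of rank $r$, there is no $G$-edge $\{v_1,u_2\}$ or $\{v_2,u_1\}$. A fast stretch is a tree path from a node to a descendant all of whose nodes have the same rank; a node $u$ is the first node of a fast stretch if $u=s$ or the rank of its parent differs from that of $u$. The virtual directed graph $G'$ consists of both orientations of every edge of $G$ plus a directed edge from each first node $u$ of a fast stretch (of rank $r$) to every descendant of $u$ in $\mathcal{T}$ having rank $r$. The virtual-distance $d_u$ is the length of a shortest directed path from $s$ to $u$ in $G'$. -}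

module Defs where

open import Data.Nat using (ℕ; zero; suc; _+_; _≤_; _⊔_; _≡ᵇ_)
open import Data.Fin using (Fin; _≟_)
open import Data.List using (List; []; _∷_; filter; map; length; foldr; allFin)
open import Data.Product using (Σ; _×_; _,_; ∃)
open import Data.Sum using (_⊎_)
open import Data.Bool using (if_then_else_)
open import Relation.Nullary using (¬_)
open import Relation.Nullary.Decidable using (¬?; _×-dec_)
open import Relation.Binary.PropositionalEquality using (_≡_; _≢_)

record Graph (n : ℕ) : Set₁ where
  field
    Adj     : Fin n → Fin n → Set
    Adj-sym : ∀ {u v} → Adj u v → Adj v u
    Adj-irr : ∀ {u} → ¬ Adj u u
open Graph public

data Walk {n : ℕ} (G : Graph n) : Fin n → Fin n → ℕ → Set where
  w-nil  : ∀ {x} → Walk G x x 0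
  w-cons : ∀ {x y z k} → Adj G x y → Walk G y z k → Walk G x z (suc k)

-- level u is the graph distance from s to u (every u reachable => G connected).
IsDistFrom : ∀ {n} → Graph n → Fin n → (Fin n → ℕ) → Set
IsDistFrom G s level =
  ∀ u → Walk G s u (level u) × (∀ k → Walk G s u k → level u ≤ k)

-- A BFS tree of G rooted at s, given by a parent function (parent s is irrelevant)
-- together with the BFS levels (= distances from s).
record BFSTree {n : ℕ} (G : Graph n) (s : Fin n) : Set where
  field
    parent      : Fin n → Fin n
    level       : Fin n → ℕ
    level-dist  : IsDistFrom G s level
    parent-adj  : ∀ u → u ≢ s → Adj G (parent u) u
    parent-lvl  : ∀ u → u ≢ s → suc (level (parent u)) ≡ level u
open BFSTree public

module _ {n : ℕ} {G : Graph n} {s : Fin n} (T : BFSTree G s) where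

  children : Fin n → List (Fin n)
  children u = filter (λ v → ¬? (v ≟ s) ×-dec (parent T v ≟ u)) (allFin n)

  maxList : List ℕ → ℕ
  maxList = foldr _⊔_ 0

  rankRule : (Fin n → ℕ) → Fin n → ℕ
  rankRule rank u with children u
  ... | []       = 1
  ... | cs@(_ ∷ _) =
    let r = maxList (map rank cs)
        c = length (filter (λ v → rank v Data.Nat.≟ r) cs)
    in if c ≡ᵇ 1 then r else suc r

  IsRank : (Fin n → ℕ) → Set
  IsRank rank = ∀ u → rank u ≡ rankRule rank u

  data Desc (u : Fin n) : Fin n → Set where
    d-refl : Desc u u
    d-step : ∀ {v} → v ≢ s → Desc u (parent T v) → Desc u v

  module _ (rank : Fin n → ℕ) where

    IsGST : Set
    IsGST = ∀ u₁ u₂ → u₁ ≢ s → u₂ ≢ s → u₁ ≢ u₂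
          → level T u₁ ≡ level T u₂
          → rank u₁ ≡ rank u₂
          → parent T u₁ ≢ parent T u₂
          → rank (parent T u₁) ≡ rank u₁
          → rank (parent T u₂) ≡ rank u₂
          → ¬ Adj G (parent T u₁) u₂ × ¬ Adj G (parent T u₂) u₁

    FirstNode : Fin n → Set
    FirstNode u = u ≡ s ⊎ (u ≢ s × rank (parent T u) ≢ rank u)

    VEdge : Fin n → Fin n → Set
    VEdge x y = Adj G x y ⊎ (FirstNode x × Desc x y × rank y ≡ rank x)

    data VPath : Fin n → Fin n → ℕ → Set where
      vp-nil  : ∀ {x} → VPath x x 0
      vp-cons : ∀ {x y z k} → VEdge x y → VPath y z k → VPath x z (suc k)

    -- d_u ≤ k  (the shortest directed s-u path in G' has length ≤ k)
    VDistLE : Fin n → ℕ → Set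
    VDistLE u k = ∃ λ l → l ≤ k × VPath s u l

module Submission where

-- Two facts combine.
--  (1) Ranks are logarithmic: a node of rank r has at least 2^r - 1
--      descendants (a rank increase needs two children of the maximal
--      rank, whose subtrees are disjoint), so 2^rank(s) ≤ n + 1 and hence
--      rank(s) ≤ ⌈log₂ n⌉ as soon as n ≥ 2.
--  (2) Descending costs two virtual hops per rank: to reach v, walk to the
--      parent p of the first node f of v's fast stretch (p has strictly
--      larger rank), take the tree edge p → f and the shortcut f → v.
--      By induction on the level, d_v + 2·rank(v) ≤ 2·rank(s) + 1.
-- Since rank(v) ≥ 1, this gives d_v ≤ 2·rank(s) - 1 ≤ 2⌈log₂ n⌉ for v ≠ s.

open import Defs
open import Data.Nat using (ℕ; _*_)
open import Data.Nat.Logarithm using (⌈log₂_⌉)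
open import Data.Fin using (Fin)

open import Data.Nat using (zero; suc; _+_; _∸_; _^_; _≤_; _<_; z≤n; s≤s; s≤s⁻¹; _≤?_; _⊔_; _≡ᵇ_; ⌈_/2⌉)
open import Data.Nat.Properties
open import Data.Nat.Logarithm using (⌈log₂⌉-mono-≤; ⌈log₂⌈n/2⌉⌉≡⌈log₂n⌉∸1; ⌈log₂2^n⌉≡n)
open import Data.Nat.Induction using (<-wellFounded)
import Data.Fin as F
open import Data.List using (List; []; _∷_; filter; map; length; foldr; allFin)
open import Data.List.Properties using (length-filter; filter-some; length-tabulate)
open import Data.List.Membership.Propositional using (_∈_; lose)
open import Data.List.Membership.Propositional.Properties using (∈-filter⁺; ∈-filter⁻; ∈-allFin; ∈-map⁺; ∈-map⁻)
open import Data.List.Relation.Unary.Any using (here; there)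
open import Data.List.Relation.Unary.Unique.Propositional using (Unique)
open import Data.List.Relation.Unary.AllPairs using (_∷_)
open import Data.List.Relation.Unary.All using (_∷_)
import Data.List.Relation.Unary.Unique.Propositional.Properties as Unique
open import Data.Product using (_×_; _,_; ∃; ∃₂; proj₁; proj₂)
open import Data.Sum using (inj₁; inj₂)
open import Data.Bool using (true; false)
import Data.Bool as Bool
open import Relation.Nullary using (¬_; yes; no; contradiction)
open import Relation.Nullary.Decidable using (¬?; _×-dec_; _⊎-dec_)
open import Relation.Unary using (Decidable)
open import Induction.WellFounded using (module All)
import Relation.Binary.Construct.On as On
open import Relation.Binary.PropositionalEquality

measureInduction : ∀ {A : Set} (μ : A → ℕ) (P : A → Set)
                 → (∀ x → (∀ {y} → μ y < μ x → P y) → P x) → ∀ x → P x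
measureInduction μ P step = All.wfRec (On.wellFounded μ <-wellFounded) _ P step

-- If 2^R ≤ m + 1 and m ≥ 2 then R ≤ ⌈log₂ m⌉: halving m lowers ⌈log₂⌉ by one.
-- (For m = 1 and R = 1 the conclusion fails, hence the side condition.)
pow≤suc⇒≤⌈log₂⌉ : ∀ R m → 2 ≤ m → 2 ^ R ≤ suc m → R ≤ ⌈log₂ m ⌉
pow≤suc⇒≤⌈log₂⌉ zero    m _   _ = z≤n
pow≤suc⇒≤⌈log₂⌉ (suc R) m 2≤m h = begin
    suc R                    ≡⟨ cong suc (⌈log₂2^n⌉≡n R) ⟨
    suc ⌈log₂ (2 ^ R) ⌉      ≤⟨ s≤s (⌈log₂⌉-mono-≤ half) ⟩
    suc ⌈log₂ ⌈ m /2⌉ ⌉      ≡⟨ cong suc (⌈log₂⌈n/2⌉⌉≡⌈log₂n⌉∸1 m) ⟩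
    suc (⌈log₂ m ⌉ ∸ 1)      ≡⟨ +-comm 1 _ ⟩
    ⌈log₂ m ⌉ ∸ 1 + 1        ≡⟨ m∸n+n≡m 1≤⌈log₂m⌉ ⟩
    ⌈log₂ m ⌉                ∎
  where
    open ≤-Reasoning
    -- 2^R + 2^R ≤ m + 1, so 2^R ≤ ⌊(m + 1)/2⌋ = ⌈m/2⌉
    half : 2 ^ R ≤ ⌈ m /2⌉
    half = subst (_≤ ⌈ m /2⌉) (sym (n≡⌊n+n/2⌋ (2 ^ R)))
             (⌊n/2⌋-mono (subst (λ k → 2 ^ R + k ≤ suc m) (+-identityʳ (2 ^ R)) h))
    1≤⌈log₂m⌉ : 1 ≤ ⌈log₂ m ⌉
    1≤⌈log₂m⌉ = ⌈log₂⌉-mono-≤ 2≤m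

∸-unfold : ∀ m k → suc m ≤ k → k ∸ m ≡ suc (k ∸ suc m)
∸-unfold zero    (suc k) _       = refl
∸-unfold (suc m) (suc k) (s≤s h) = ∸-unfold m k h

≡ᵇ-false⇒≢ : ∀ {m k} → (m ≡ᵇ k) ≡ false → m ≢ k
≡ᵇ-false⇒≢ {m} m≡ᵇk m≡k = contradiction (subst Bool.T m≡ᵇk (≡⇒≡ᵇ m _ m≡k)) λ ()

two-distinct : ∀ {A : Set} {x : A} {xs : List A} → Unique xs → x ∈ xs → length xs ≢ 1
             → ∃₂ λ a b → a ∈ xs × b ∈ xs × a ≢ b
two-distinct {xs = _ ∷ []}    _               _ len≢1 = contradiction refl len≢1
two-distinct {xs = _ ∷ _ ∷ _} ((a≢b ∷ _) ∷ _) _ _     = _ , _ , here refl , there (here refl) , a≢b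

maxList-ub : ∀ {x} xs → x ∈ xs → x ≤ foldr _⊔_ 0 xs
maxList-ub (y ∷ xs) (here refl) = m≤m⊔n y _
maxList-ub (y ∷ xs) (there x∈) = ≤-trans (maxList-ub xs x∈) (m≤n⊔m y _)

maxList-∈ : ∀ x xs → foldr _⊔_ 0 (x ∷ xs) ∈ x ∷ xs
maxList-∈ x []       = here (⊔-identityʳ x)
maxList-∈ x (y ∷ xs) with ⊔-sel x (foldr _⊔_ 0 (y ∷ xs))
... | inj₁ max≡x = here max≡x
... | inj₂ max≡r = there (subst (_∈ y ∷ xs) (sym max≡r) (maxList-∈ y xs))

filter-disjoint : ∀ {A : Set} {P Q R : A → Set} (P? : Decidable P) (Q? : Decidable Q) (R? : Decidable R)
                → (∀ {x} → P x → R x) → (∀ {x} → Q x → R x) → (∀ {x} → P x → ¬ Q x)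
                → ∀ xs → length (filter P? xs) + length (filter Q? xs) ≤ length (filter R? xs)
filter-disjoint P? Q? R? P⊆R Q⊆R P∩Q=∅ [] = z≤n
filter-disjoint P? Q? R? P⊆R Q⊆R P∩Q=∅ (x ∷ xs)
  with IH ← filter-disjoint P? Q? R? P⊆R Q⊆R P∩Q=∅ xs | P? x | Q? x | R? x
... | yes p | yes q | _     = contradiction q (P∩Q=∅ p)
... | yes _ | no _  | yes _ = s≤s IH
... | yes p | no _  | no ¬r = contradiction (P⊆R p) ¬r
... | no _  | yes _ | yes _ = subst (_≤ suc (length (filter R? xs)))
                                 (sym (+-suc (length (filter P? xs)) (length (filter Q? xs)))) (s≤s IH)
... | no _  | yes q | no ¬r = contradiction (Q⊆R q) ¬r
... | no _  | no _  | yes _ = m≤n⇒m≤1+n IH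
... | no _  | no _  | no _  = IH

module Subtrees {n : ℕ} {G : Graph n} {s : Fin n} (T : BFSTree G s) where

  Child : Fin n → Fin n → Set
  Child c u = c ≢ s × parent T c ≡ u

  child? : ∀ u → Decidable (λ c → Child c u)
  child? u c = ¬? (c F.≟ s) ×-dec (parent T c F.≟ u)

  children⇒Child : ∀ {c u} → c ∈ children T u → Child c u
  children⇒Child {u = u} c∈ = proj₂ (∈-filter⁻ (child? u) {xs = allFin n} c∈)

  Child⇒children : ∀ {c u} → Child c u → c ∈ children T u
  Child⇒children {c} {u} = ∈-filter⁺ (child? u) (∈-allFin c)

  children≡⇒Child : ∀ {u cs c} → children T u ≡ cs → c ∈ cs → Child c u
  children≡⇒Child refl = children⇒Child

  children-unique : ∀ u → Unique (children T u)
  children-unique u = Unique.filter⁺ (child? u) (Unique.allFin⁺ n)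

  child-level : ∀ {c u} → Child c u → level T c ≡ suc (level T u)
  child-level {c} (c≢s , refl) = sym (parent-lvl T c c≢s)

  ancestor : ℕ → Fin n → Fin n
  ancestor zero    v = v
  ancestor (suc k) v = parent T (ancestor k v)

  -- Below u v : v lies in the subtree of u; decidable, unlike Desc.
  Below : Fin n → Fin n → Set
  Below u v = level T u ≤ level T v × ancestor (level T v ∸ level T u) v ≡ u

  below? : ∀ u → Decidable (Below u)
  below? u v = (level T u ≤? level T v) ×-dec (ancestor (level T v ∸ level T u) v F.≟ u)

  below-refl : ∀ u → Below u u
  below-refl u = ≤-refl , cong (λ k → ancestor k u) (n∸n≡0 (level T u))

  below-parent : ∀ {c u v} → Child c u → Below c v → Below u v
  below-parent {c} {u} {v} c→u (Lc≤Lv , anc≡c) = ≤-trans (n≤1+n _) Lu<Lv , (begin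
      ancestor (level T v ∸ level T u) v          ≡⟨ cong (λ k → ancestor k v) (∸-unfold _ _ Lu<Lv) ⟩
      parent T (ancestor (level T v ∸ suc (level T u)) v)
                                                  ≡⟨ cong (λ l → parent T (ancestor (level T v ∸ l) v)) (child-level c→u) ⟨
      parent T (ancestor (level T v ∸ level T c) v) ≡⟨ cong (parent T) anc≡c ⟩
      parent T c                                  ≡⟨ proj₂ c→u ⟩
      u                                           ∎)
    where
      open ≡-Reasoning
      Lu<Lv : suc (level T u) ≤ level T v
      Lu<Lv = subst (_≤ level T v) (child-level c→u) Lc≤Lv

  child-not-above : ∀ {c u} → Child c u → ¬ Below c u
  child-not-above {u = u} c→u (Lc≤Lu , _) = 1+n≰n (subst (_≤ level T u) (child-level c→u) Lc≤Lu)

  below-disjoint : ∀ {a b v} → level T a ≡ level T b → Below a v → Below b v → a ≡ b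
  below-disjoint La≡Lb (_ , anc≡a) (_ , anc≡b) rewrite La≡Lb = trans (sym anc≡a) anc≡b

  size : Fin n → ℕ
  size u = length (filter (below? u) (allFin n))

  size≤n : ∀ u → size u ≤ n
  size≤n u = subst (size u ≤_) (length-tabulate {n = n} (λ x → x)) (length-filter (below? u) (allFin n))

  size≥1 : ∀ u → 1 ≤ size u
  size≥1 u = filter-some (below? u) (lose (∈-allFin u) (below-refl u))

  count-self : ∀ u → 1 ≤ length (filter (u F.≟_) (allFin n))
  count-self u = filter-some (u F.≟_) (∈-allFin u)

  -- the subtree of a child misses at least u
  size-child : ∀ {c u} → Child c u → suc (size c) ≤ size u
  size-child {c} {u} c→u = begin
      suc (size c)                                     ≡⟨ +-comm 1 _ ⟩
      size c + 1                                       ≤⟨ +-monoʳ-≤ (size c) (count-self u) ⟩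
      size c + length (filter (u F.≟_) (allFin n))     ≤⟨ filter-disjoint (below? c) (u F.≟_) (below? u)
                                                            (below-parent c→u) (λ { refl → below-refl u })
                                                            (λ { c↓u refl → child-not-above c→u c↓u }) (allFin n) ⟩
      size u                                           ∎
    where open ≤-Reasoning

  -- two distinct children contribute disjoint subtrees
  size-children : ∀ {a b u} → Child a u → Child b u → a ≢ b → suc (size a + size b) ≤ size u
  size-children {a} {b} {u} a→u b→u a≢b = begin
      suc (size a + size b)                   ≡⟨ +-comm 1 _ ⟩
      size a + size b + 1                     ≤⟨ +-mono-≤ a∪b (count-self u) ⟩
      #a∪b + length (filter (u F.≟_) (allFin n))
                                              ≤⟨ filter-disjoint (λ v → below? a v ⊎-dec below? b v) (u F.≟_) (below? u)
                                                   (λ { (inj₁ a↓) → below-parent a→u a↓ ; (inj₂ b↓) → below-parent b→u b↓ })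
                                                   (λ { refl → below-refl u })
                                                   (λ { (inj₁ a↓u) refl → child-not-above a→u a↓u
                                                      ; (inj₂ b↓u) refl → child-not-above b→u b↓u })
                                                   (allFin n) ⟩
      size u                                  ∎
    where
      open ≤-Reasoning
      #a∪b : ℕ
      #a∪b = length (filter (λ v → below? a v ⊎-dec below? b v) (allFin n))
      a∪b : size a + size b ≤ #a∪b
      a∪b = filter-disjoint (below? a) (below? b) (λ v → below? a v ⊎-dec below? b v) inj₁ inj₂
              (λ a↓ b↓ → a≢b (below-disjoint (trans (child-level a→u) (sym (child-level b→u))) a↓ b↓))
              (allFin n)

module Ranks {n : ℕ} {G : Graph n} {s : Fin n} (T : BFSTree G s)
             (rank : Fin n → ℕ) (isRank : IsRank T rank) where

  open Subtrees T

  maxRank : List (Fin n) → ℕ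
  maxRank cs = maxList T (map rank cs)

  ≤maxRank : ∀ {c cs} → c ∈ cs → rank c ≤ maxRank cs
  ≤maxRank {cs = cs} c∈ = maxList-ub (map rank cs) (∈-map⁺ rank c∈)

  maxRank-attained : ∀ c cs → ∃ λ x → x ∈ c ∷ cs × rank x ≡ maxRank (c ∷ cs)
  maxRank-attained c cs with ∈-map⁻ rank (maxList-∈ (rank c) (map rank cs))
  ... | x , x∈ , max≡rx = x , x∈ , sym max≡rx

  atMax : (cs : List (Fin n)) → Decidable (λ v → rank v ≡ maxRank cs)
  atMax cs v = rank v ≟ maxRank cs

  tied-max : ∀ c cs → Unique (c ∷ cs)
           → length (filter (atMax (c ∷ cs)) (c ∷ cs)) ≢ 1
           → ∃₂ λ a b → a ∈ c ∷ cs × b ∈ c ∷ cs × a ≢ b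
                      × rank a ≡ maxRank (c ∷ cs) × rank b ≡ maxRank (c ∷ cs)
  tied-max c cs unique several
    with x , x∈ , rx≡max ← maxRank-attained c cs
    with a , b , a∈ , b∈ , a≢b ← two-distinct (Unique.filter⁺ (atMax (c ∷ cs)) unique)
                                              (∈-filter⁺ (atMax (c ∷ cs)) x∈ rx≡max) several
    with a∈cs , ra≡max ← ∈-filter⁻ (atMax (c ∷ cs)) {xs = c ∷ cs} a∈
    with b∈cs , rb≡max ← ∈-filter⁻ (atMax (c ∷ cs)) {xs = c ∷ cs} b∈
    = a , b , a∈cs , b∈cs , a≢b , ra≡max , rb≡max

  data RankCase (u : Fin n) : Set where
    leaf     : rank u ≡ 1 → RankCase u
    inherit  : ∀ {c} → Child c u → rank c ≡ rank u → RankCase u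
    increase : ∀ {a b} → Child a u → Child b u → a ≢ b
             → rank a ≡ rank b → suc (rank a) ≡ rank u → RankCase u

  rankCase : ∀ u → RankCase u
  rankCase u with children T u in ch≡ | isRank u
  ... | []     | ru = leaf ru
  ... | c ∷ cs | ru
    with length (filter (atMax (c ∷ cs)) (c ∷ cs)) ≡ᵇ 1 in once | ru
  ... | true  | ru′ with x , x∈ , rx≡max ← maxRank-attained c cs
    = inherit (children≡⇒Child ch≡ x∈) (trans rx≡max (sym ru′))
  ... | false | ru′
    with a , b , a∈ , b∈ , a≢b , ra≡max , rb≡max
           ← tied-max c cs (subst Unique ch≡ (children-unique u)) (≡ᵇ-false⇒≢ once)
    = increase (children≡⇒Child ch≡ a∈) (children≡⇒Child ch≡ b∈) a≢b
               (trans ra≡max (sym rb≡max)) (trans (cong suc ra≡max) (sym ru′))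

  child-rank≤ : ∀ {c u} → Child c u → rank c ≤ rank u
  child-rank≤ {c} {u} c→u with children T u | isRank u | Child⇒children c→u
  ... | []      | _  | ()
  ... | c₀ ∷ cs | ru | c∈
    with length (filter (atMax (c₀ ∷ cs)) (c₀ ∷ cs)) ≡ᵇ 1 | ru
  ... | true  | ru′ = ≤-trans (≤maxRank c∈) (≤-reflexive (sym ru′))
  ... | false | ru′ = ≤-trans (≤maxRank c∈) (≤-trans (n≤1+n _) (≤-reflexive (sym ru′)))

  RankBound : Fin n → Set
  RankBound u = 1 ≤ rank u × 2 ^ rank u ≤ suc (size u)

  rankBound : ∀ u → RankBound u
  rankBound = measureInduction size RankBound step
    where
      step : ∀ u → (∀ {v} → size v < size u → RankBound v) → RankBound u
      step u IH with rankCase u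
      ... | leaf ru≡1 rewrite ru≡1 = ≤-refl , s≤s (size≥1 u)
      ... | inherit c→u rc≡ru rewrite sym rc≡ru with 1≤rc , 2^rc≤ ← IH (size-child c→u)
        = 1≤rc , ≤-trans 2^rc≤ (s≤s (<⇒≤ (size-child c→u)))
      ... | increase {a} {b} a→u b→u a≢b ra≡rb 1+ra≡ru rewrite sym 1+ra≡ru
        with _ , 2^ra≤ ← IH (size-child a→u) | _ , 2^rb≤ ← IH (size-child b→u)
        = s≤s z≤n , (begin
            2 ^ rank a + (2 ^ rank a + 0) ≡⟨ cong (λ k → 2 ^ rank a + k) (+-identityʳ _) ⟩
            2 ^ rank a + 2 ^ rank a       ≤⟨ +-mono-≤ 2^ra≤ (subst (λ r → 2 ^ r ≤ suc (size b)) (sym ra≡rb) 2^rb≤) ⟩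
            suc (size a) + suc (size b)   ≡⟨ cong suc (+-suc (size a) (size b)) ⟩
            suc (suc (size a + size b))   ≤⟨ s≤s (size-children a→u b→u a≢b) ⟩
            suc (size u)                  ∎)
        where open ≤-Reasoning

  rank≤⌈log₂n⌉ : 2 ≤ n → ∀ u → rank u ≤ ⌈log₂ n ⌉
  rank≤⌈log₂n⌉ 2≤n u = pow≤suc⇒≤⌈log₂⌉ (rank u) n 2≤n (≤-trans (proj₂ (rankBound u)) (s≤s (size≤n u)))

-- Two hops are paid for by a rank decrease of at least one.
two-hops : ∀ l p r B → l + 2 * p ≤ B → suc r ≤ p → suc (suc l) + 2 * r ≤ B
two-hops l p r B bound r<p = begin
    suc (suc l) + 2 * r   ≡⟨ cong suc (+-suc l (2 * r)) ⟨
    suc (l + suc (2 * r)) ≡⟨ +-suc l (suc (2 * r)) ⟨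
    l + (2 + 2 * r)       ≡⟨ cong (l +_) (*-suc 2 r) ⟨
    l + 2 * suc r         ≤⟨ +-monoʳ-≤ l (*-monoʳ-≤ 2 r<p) ⟩
    l + 2 * p             ≤⟨ bound ⟩
    B                     ∎
  where open ≤-Reasoning

length-bound : ∀ l r R → l + 2 * r ≤ suc (2 * R) → 1 ≤ r → l ≤ 2 * R
length-bound l r R bound 1≤r = <⇒≤ (s≤s⁻¹ (begin
    suc (suc l)  ≡⟨ +-comm 2 l ⟩
    l + 2        ≤⟨ +-monoʳ-≤ l (*-monoʳ-≤ 2 1≤r) ⟩
    l + 2 * r    ≤⟨ bound ⟩
    suc (2 * R)  ∎))
  where open ≤-Reasoning

module VirtualPaths {n : ℕ} {G : Graph n} {s : Fin n} (T : BFSTree G s)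
                    (rank : Fin n → ℕ) (isRank : IsRank T rank) where

  open Ranks T rank isRank

  parent-level< : ∀ v → v ≢ s → level T (parent T v) < level T v
  parent-level< v v≢s = ≤-reflexive (parent-lvl T v v≢s)

  StretchStart : Fin n → Set
  StretchStart v = ∃ λ f → FirstNode T rank f × Desc T f v × rank v ≡ rank f × level T f ≤ level T v

  stretchStart : ∀ v → StretchStart v
  stretchStart = measureInduction (level T) StretchStart step
    where
      step : ∀ v → (∀ {w} → level T w < level T v → StretchStart w) → StretchStart v
      step v IH with v F.≟ s
      ... | yes refl = s , inj₁ refl , d-refl , refl , ≤-refl
      ... | no v≢s with rank (parent T v) ≟ rank v
      ...   | no rp≢rv = v , inj₂ (v≢s , rp≢rv) , d-refl , refl , ≤-refl
      ...   | yes rp≡rv with f , first , f↓p , rp≡rf , Lf≤Lp ← IH (parent-level< v v≢s)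
        = f , first , d-step v≢s f↓p , trans (sym rp≡rv) rp≡rf , ≤-trans Lf≤Lp (<⇒≤ (parent-level< v v≢s))

  _▷_ : ∀ {x y z l} → VPath T rank x y l → VEdge T rank y z → VPath T rank x z (suc l)
  vp-nil      ▷ e′ = vp-cons e′ vp-nil
  vp-cons e p ▷ e′ = vp-cons e (p ▷ e′)

  -- Reaching v costs at most 2·(rank s − rank v) + 1 virtual hops: the
  -- parent p of v's stretch start f has larger rank, and p → f → v are two hops.
  Reachable : Fin n → Set
  Reachable v = ∃ λ l → VPath T rank s v l × l + 2 * rank v ≤ suc (2 * rank s)

  reach : ∀ v → Reachable v
  reach = measureInduction (level T) Reachable step
    where
      step : ∀ v → (∀ {w} → level T w < level T v → Reachable w) → Reachable v
      step v IH with stretchStart v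
      ... | f , first , f↓v , rv≡rf , Lf≤Lv with first
      ...   | inj₁ refl = 1 , vp-cons shortcut vp-nil , s≤s (≤-reflexive (cong (2 *_) rv≡rf))
        where shortcut = inj₂ (first , f↓v , rv≡rf)
      ...   | inj₂ (f≢s , rp≢rf)
        with l , path , bound ← IH (≤-trans (parent-level< f f≢s) Lf≤Lv)
        = suc (suc l) , (path ▷ inj₁ (parent-adj T f f≢s)) ▷ shortcut ,
          two-hops l (rank (parent T f)) (rank v) _ bound rv<rp
        where
          shortcut = inj₂ (first , f↓v , rv≡rf)
          rv<rp : suc (rank v) ≤ rank (parent T f)
          rv<rp = subst (λ r → suc r ≤ rank (parent T f)) (sym rv≡rf)
                    (≤∧≢⇒< (child-rank≤ (f≢s , refl)) (λ rf≡rp → rp≢rf (sym rf≡rp)))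

distinct⇒2≤n : ∀ {n} (x y : Fin n) → x ≢ y → 2 ≤ n
distinct⇒2≤n {suc zero}    F.zero F.zero x≢y = contradiction refl x≢y
distinct⇒2≤n {suc (suc n)} _      _      _   = s≤s (s≤s z≤n)

lemma7 : (n : ℕ) (G : Graph n) (s : Fin n) (T : BFSTree G s) (rank : Fin n → ℕ)
         → IsRank T rank → IsGST T rank
         → (u : Fin n) → VDistLE T rank u (2 * ⌈log₂ n ⌉)
lemma7 n G s T rank isRank _ u with u F.≟ s
... | yes refl = 0 , z≤n , vp-nil
... | no u≢s with l , path , bound ← VirtualPaths.reach T rank isRank u =
  l , ≤-trans (length-bound l (rank u) (rank s) bound 1≤ru) (*-monoʳ-≤ 2 rs≤log) , path
  where
    open Ranks T rank isRank using (rankBound; rank≤⌈log₂n⌉)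
    1≤ru : 1 ≤ rank u
    1≤ru = proj₁ (rankBound u)
    rs≤log : rank s ≤ ⌈log₂ n ⌉
    rs≤log = rank≤⌈log₂n⌉ (distinct⇒2≤n u s u≢s) s
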